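{- Let $M$ be a block matroid of rank $r\geq 1$ with ground set $E$. Suppose that either $C=\{e,f\}\subseteq E$ is a cocircuit of $M$ and $N=M\setminus C$, or $C=\{e,f\}$ is a circuit of $M$ and $N=M/C$. Then $N$ is a block matroid of rank $r-1$, and $$\mathcal{B}_M\cap\mathcal{B}_{M^\ast}=\mathcal{B}_{M'}\cap\mathcal{B}_{M'^\ast},$$ where $M'=U_{1,2}\oplus N$ is the matroid on $E$ given by the direct sum of the uniform matroid $U_{1,2}$ on $C$ and $N$ on $E\setminus C$.
   Context: For a matroid $M$ on $E$, $\mathcal{B}_M$ is its set of bases and $\mathcal{B}_{M^\ast}=\{E\setminus B: B\in\mathcal{B}_M\}$ is the set of bases of the dual. $M$ is a block matroid if $\mathcal{B}_M\cap\mathcal{B}_{M^\ast}\ne\emptyset$. -}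

module Defs where

open import Data.Nat using (ℕ)
open import Data.Fin using (Fin)
open import Data.Fin.Subset
open import Data.Product using (Σ; ∃; ∃-syntax; _×_)
open import Data.Sum using (_⊎_; inj₁; inj₂)
open import Relation.Nullary using (¬_)
open import Relation.Binary.PropositionalEquality using (_≡_)

record SetSystem (n : ℕ) : Set₁ where
  field
    ground : Subset n
    IsBase : Subset n → Set
open SetSystem public

record Matroid (n : ℕ) : Set₁ where
  field
    sys          : SetSystem n
    base⊆ground  : ∀ B → IsBase sys B → B ⊆ ground sys
    base-exists  : ∃[ B ] IsBase sys B
    exchange     : ∀ B₁ B₂ → IsBase sys B₁ → IsBase sys B₂ →
                   ∀ x → x ∈ B₁ → x ∉ B₂ →
                   ∃[ y ] (y ∈ B₂ × y ∉ B₁ × IsBase sys ((B₁ - x) ∪ ⁅ y ⁆))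
open Matroid public

module _ {n : ℕ} where

  dual : SetSystem n → SetSystem n
  dual S = record { ground = ground S
                  ; IsBase = λ B → B ⊆ ground S × IsBase S (ground S ─ B) }

  Independent : SetSystem n → Subset n → Set
  Independent S I = ∃[ B ] (IsBase S B × I ⊆ B)

  Dependent : SetSystem n → Subset n → Set
  Dependent S D = D ⊆ ground S × ¬ Independent S D

  IsCircuit : SetSystem n → Subset n → Set
  IsCircuit S C = Dependent S C × (∀ D → D ⊂ C → Independent S D)

  IsCocircuit : SetSystem n → Subset n → Set
  IsCocircuit S C = IsCircuit (dual S) C

  delete : SetSystem n → Subset n → SetSystem n
  delete S X = record
    { ground = ground S ─ X
    ; IsBase = λ B → Independent S B × B ⊆ ground S ─ X ×
                     (∀ J → Independent S J → J ⊆ ground S ─ X → B ⊆ J → J ⊆ B) }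

  contract : SetSystem n → Subset n → SetSystem n
  contract S X = dual (delete (dual S) X)

  uniform : ℕ → Subset n → SetSystem n
  uniform k C = record { ground = C ; IsBase = λ B → B ⊆ C × ∣ B ∣ ≡ k }

  -- direct sum (of set systems on disjoint ground sets)
  _⊕_ : SetSystem n → SetSystem n → SetSystem n
  S ⊕ T = record
    { ground = ground S ∪ ground T
    ; IsBase = λ B → ∃[ B₁ ] ∃[ B₂ ] (IsBase S B₁ × IsBase T B₂ × B ≡ B₁ ∪ B₂) }

  HasRank : SetSystem n → ℕ → Set
  HasRank S r = ∀ B → IsBase S B → ∣ B ∣ ≡ r

  CommonBase : SetSystem n → Subset n → Set
  CommonBase S B = IsBase S B × IsBase (dual S) B

  IsBlock : SetSystem n → Set
  IsBlock S = ∃[ B ] CommonBase S B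

  minor : (S : SetSystem n) (C : Subset n) → IsCocircuit S C ⊎ IsCircuit S C → SetSystem n
  minor S C (inj₁ _) = delete S C
  minor S C (inj₂ _) = contract S C

-- A two-element cocircuit C = {x, y} of M meets every base, and neither x nor y is a
-- coloop. Hence every base of M ∖ C extends by either element of C to a base of M and,
-- by counting, every B′ ⊆ E ─ C extending to a base is a base of M ∖ C; so M ∖ C has rank
-- r − 1. A common base B of M and M* contains exactly one element of C, since its
-- complement is also a base; so B ─ C and (E ─ B) ─ C are bases of M ∖ C, which makes
-- B a common base of U₁,₂ ⊕ M ∖ C, and the converse is the extension property again.
-- A two-element circuit of M is a cocircuit of M*, a matroid of the same rank because
-- |E| = 2r, and M / C = (M* ∖ C)*; dualizing a direct summand of U₁,₂ ⊕ M* ∖ C does not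
-- change its common bases.

module Submission where

open import Defs
open import Data.Nat using (ℕ; _≥_; _∸_)
open import Data.Fin using (Fin)
open import Data.Fin.Subset using (Subset; _∈_; _∪_; _─_; ⁅_⁆)
open import Data.Product using (_×_)
open import Data.Sum using (_⊎_)
open import Function.Bundles using (_⇔_)
open import Relation.Nullary using (¬_)
open import Relation.Binary.PropositionalEquality using (_≡_)

open import Data.Nat using (suc; pred; _+_; _≤_; _<_; s≤s⁻¹)
open import Data.Nat.Properties using (+-suc; +-cancelʳ-≡; <⇒≱; <⇒≢; <-≤-trans; ≤-refl; ≤-reflexive)
open import Data.Fin using (zero; suc) renaming (_≟_ to _≟ᶠ_)
open import Data.Fin.Subset using (inside; outside; ⊥; _∉_; _⊆_; _⊂_; _∩_; _-_; ∣_∣)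
open import Data.Fin.Subset.Properties
open import Data.Vec.Base using ([]; _∷_; here; there)
open import Data.Product using (∃-syntax; _,_; proj₁; proj₂; map₂)
open import Data.Sum using (inj₁; inj₂; [_,_])
open import Data.Empty using (⊥-elim)
open import Function using (_∘_; id)
open import Function.Bundles using (mk⇔; Equivalence)
open import Function.Properties.Equivalence using (⇔-setoid)
open import Level using (0ℓ)
import Relation.Binary.Reasoning.Setoid as SetoidReasoning
open import Relation.Nullary using (yes; no; contradiction)
open import Relation.Binary.PropositionalEquality using (_≢_; refl; sym; trans; cong; cong₂; subst; module ≡-Reasoning)

private variable
  n r s : ℕ
  x y z w w′ : Fin n
  p q : Subset n
  A B B′ X : Subset n
  R T T′ : SetSystem n

-- Subsets of Fin n

x∈p─q⇒x∉q : ∀ (p q : Subset n) → x ∈ p ─ q → x ∉ q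
x∈p─q⇒x∉q (inside ∷ p) (outside ∷ q) here ()
x∈p─q⇒x∉q (_ ∷ p) (_ ∷ q) (there x∈p─q) (there x∈q) = x∈p─q⇒x∉q p q x∈p─q x∈q

x∈p∧x∉p─q⇒x∈q : x ∈ p → x ∉ p ─ q → x ∈ q
x∈p∧x∉p─q⇒x∈q {x = x} {q = q} x∈p x∉p─q with x ∈? q
... | yes x∈q = x∈q
... | no  x∉q = contradiction (x∈p∧x∉q⇒x∈p─q x∈p x∉q) x∉p─q

p⊆q⇒q─[q─p]≡p : ∀ (p q : Subset n) → p ⊆ q → q ─ (q ─ p) ≡ p
p⊆q⇒q─[q─p]≡p []            []            _   = refl
p⊆q⇒q─[q─p]≡p (inside ∷ p)  (inside ∷ q)  p⊆q = cong (inside ∷_) (p⊆q⇒q─[q─p]≡p p q (drop-∷-⊆ p⊆q))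
p⊆q⇒q─[q─p]≡p (inside ∷ p)  (outside ∷ q) p⊆q = contradiction (p⊆q here) λ ()
p⊆q⇒q─[q─p]≡p (outside ∷ p) (inside ∷ q)  p⊆q = cong (outside ∷_) (p⊆q⇒q─[q─p]≡p p q (drop-∷-⊆ p⊆q))
p⊆q⇒q─[q─p]≡p (outside ∷ p) (outside ∷ q) p⊆q = cong (outside ∷_) (p⊆q⇒q─[q─p]≡p p q (drop-∷-⊆ p⊆q))

p⊆q⇒p∪[q─p]≡q : ∀ (p q : Subset n) → p ⊆ q → p ∪ (q ─ p) ≡ q
p⊆q⇒p∪[q─p]≡q []            []            _   = refl
p⊆q⇒p∪[q─p]≡q (inside ∷ p)  (inside ∷ q)  p⊆q = cong (inside ∷_) (p⊆q⇒p∪[q─p]≡q p q (drop-∷-⊆ p⊆q))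
p⊆q⇒p∪[q─p]≡q (inside ∷ p)  (outside ∷ q) p⊆q = contradiction (p⊆q here) λ ()
p⊆q⇒p∪[q─p]≡q (outside ∷ p) (inside ∷ q)  p⊆q = cong (inside ∷_) (p⊆q⇒p∪[q─p]≡q p q (drop-∷-⊆ p⊆q))
p⊆q⇒p∪[q─p]≡q (outside ∷ p) (outside ∷ q) p⊆q = cong (outside ∷_) (p⊆q⇒p∪[q─p]≡q p q (drop-∷-⊆ p⊆q))

p⊆q⇒∣p∣+∣q─p∣≡∣q∣ : ∀ (p q : Subset n) → p ⊆ q → ∣ p ∣ + ∣ q ─ p ∣ ≡ ∣ q ∣
p⊆q⇒∣p∣+∣q─p∣≡∣q∣ []            []            _   = refl
p⊆q⇒∣p∣+∣q─p∣≡∣q∣ (inside ∷ p)  (inside ∷ q)  p⊆q = cong suc (p⊆q⇒∣p∣+∣q─p∣≡∣q∣ p q (drop-∷-⊆ p⊆q))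
p⊆q⇒∣p∣+∣q─p∣≡∣q∣ (inside ∷ p)  (outside ∷ q) p⊆q = contradiction (p⊆q here) λ ()
p⊆q⇒∣p∣+∣q─p∣≡∣q∣ (outside ∷ p) (inside ∷ q)  p⊆q =
  trans (+-suc ∣ p ∣ ∣ q ─ p ∣) (cong suc (p⊆q⇒∣p∣+∣q─p∣≡∣q∣ p q (drop-∷-⊆ p⊆q)))
p⊆q⇒∣p∣+∣q─p∣≡∣q∣ (outside ∷ p) (outside ∷ q) p⊆q = p⊆q⇒∣p∣+∣q─p∣≡∣q∣ p q (drop-∷-⊆ p⊆q)

x∉p⇒∣⁅x⁆∪p∣≡1+∣p∣ : ∀ (p : Subset n) → x ∉ p → ∣ ⁅ x ⁆ ∪ p ∣ ≡ suc ∣ p ∣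
x∉p⇒∣⁅x⁆∪p∣≡1+∣p∣ {x = zero}  (inside ∷ p)  x∉p = contradiction here x∉p
x∉p⇒∣⁅x⁆∪p∣≡1+∣p∣ {x = zero}  (outside ∷ p) _   = cong (suc ∘ ∣_∣) (∪-identityˡ p)
x∉p⇒∣⁅x⁆∪p∣≡1+∣p∣ {x = suc x} (inside ∷ p)  x∉p = cong suc (x∉p⇒∣⁅x⁆∪p∣≡1+∣p∣ p (x∉p ∘ there))
x∉p⇒∣⁅x⁆∪p∣≡1+∣p∣ {x = suc x} (outside ∷ p) x∉p = x∉p⇒∣⁅x⁆∪p∣≡1+∣p∣ p (x∉p ∘ there)

∣p∣≡1⇒p≡⁅x⁆ : ∀ (p : Subset n) → ∣ p ∣ ≡ 1 → ∃[ x ] p ≡ ⁅ x ⁆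
∣p∣≡1⇒p≡⁅x⁆ (inside ∷ p)  ∣p∣≡1 = zero , cong (inside ∷_) (∣p∣≡0⇒p≡⊥ p (cong pred ∣p∣≡1))
  where
  ∣p∣≡0⇒p≡⊥ : ∀ {n} (p : Subset n) → ∣ p ∣ ≡ 0 → p ≡ ⊥
  ∣p∣≡0⇒p≡⊥ []            _     = refl
  ∣p∣≡0⇒p≡⊥ (outside ∷ p) ∣p∣≡0 = cong (outside ∷_) (∣p∣≡0⇒p≡⊥ p ∣p∣≡0)
∣p∣≡1⇒p≡⁅x⁆ (outside ∷ p) ∣p∣≡1 with ∣p∣≡1⇒p≡⁅x⁆ p ∣p∣≡1
... | x , p≡⁅x⁆ = suc x , cong (outside ∷_) p≡⁅x⁆

p⊆q∧∣q∣≤∣p∣⇒q⊆p : p ⊆ q → ∣ q ∣ ≤ ∣ p ∣ → q ⊆ p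
p⊆q∧∣q∣≤∣p∣⇒q⊆p {p = p} p⊆q ∣q∣≤∣p∣ {z} z∈q with z ∈? p
... | yes z∈p = z∈p
... | no  z∉p = contradiction ∣q∣≤∣p∣ (<⇒≱ (p⊂q⇒∣p∣<∣q∣ (p⊆q , z , z∈q , z∉p)))

∣[p-x]∪⁅y⁆─q∣<∣p─q∣ : x ∈ p → x ∉ q → y ∈ q → ∣ ((p - x) ∪ ⁅ y ⁆) ─ q ∣ < ∣ p ─ q ∣
∣[p-x]∪⁅y⁆─q∣<∣p─q∣ {x = x} {p = p} {q = q} {y = y} x∈p x∉q y∈q =
  p⊂q⇒∣p∣<∣q∣ (smaller , x , x∈p∧x∉q⇒x∈p─q x∈p x∉q , x-gone)
  where
  smaller : ((p - x) ∪ ⁅ y ⁆) ─ q ⊆ p ─ q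
  smaller {z} z∈ with x∈p∪q⁻ (p - x) ⁅ y ⁆ (p─q⊆p _ q z∈)
  ... | inj₁ z∈p-x = x∈p∧x∉q⇒x∈p─q (p─q⊆p p ⁅ x ⁆ z∈p-x) (x∈p─q⇒x∉q _ q z∈)
  ... | inj₂ z∈⁅y⁆ = contradiction (subst (_∈ q) (sym (x∈⁅y⁆⇒x≡y y z∈⁅y⁆)) y∈q) (x∈p─q⇒x∉q _ q z∈)
  x-gone : x ∉ ((p - x) ∪ ⁅ y ⁆) ─ q
  x-gone x∈ with x∈p∪q⁻ (p - x) ⁅ y ⁆ (p─q⊆p _ q x∈)
  ... | inj₁ x∈p-x = x∈p─q⇒x∉q p ⁅ x ⁆ x∈p-x (x∈⁅x⁆ x)
  ... | inj₂ x∈⁅y⁆ = x∉q (subst (_∈ q) (sym (x∈⁅y⁆⇒x≡y y x∈⁅y⁆)) y∈q)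

p─[q-x∪⁅y⁆]≡[p─q]-y∪⁅x⁆ : q ⊆ p → x ∈ q → y ∉ q → p ─ ((q - x) ∪ ⁅ y ⁆) ≡ ((p ─ q) - y) ∪ ⁅ x ⁆
p─[q-x∪⁅y⁆]≡[p─q]-y∪⁅x⁆ {q = q} {p = p} {x = x} {y = y} q⊆p x∈q y∉q = ⊆-antisym ⊆ʳ ⊆ˡ
  where
  ⊆ʳ : p ─ ((q - x) ∪ ⁅ y ⁆) ⊆ ((p ─ q) - y) ∪ ⁅ x ⁆
  ⊆ʳ {z} z∈ with z ≟ᶠ x
  ... | yes refl = q⊆p∪q _ ⁅ x ⁆ (x∈⁅x⁆ x)
  ... | no  z≢x  = p⊆p∪q ⁅ x ⁆ (x∈p∧x≢y⇒x∈p-y (x∈p∧x∉q⇒x∈p─q (p─q⊆p p _ z∈) z∉q) z≢y)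
    where
    z∉ : z ∉ (q - x) ∪ ⁅ y ⁆
    z∉ = x∈p─q⇒x∉q p _ z∈
    z∉q : z ∉ q
    z∉q z∈q = z∉ (p⊆p∪q ⁅ y ⁆ (x∈p∧x≢y⇒x∈p-y z∈q z≢x))
    z≢y : z ≢ y
    z≢y refl = z∉ (q⊆p∪q _ ⁅ z ⁆ (x∈⁅x⁆ z))
  ⊆ˡ : ((p ─ q) - y) ∪ ⁅ x ⁆ ⊆ p ─ ((q - x) ∪ ⁅ y ⁆)
  ⊆ˡ {z} z∈ with x∈p∪q⁻ _ ⁅ x ⁆ z∈
  ... | inj₁ z∈p─q-y = x∈p∧x∉q⇒x∈p─q (p─q⊆p p q z∈p─q) z∉
    where
    z∈p─q = p─q⊆p _ ⁅ y ⁆ z∈p─q-y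
    z∉ : z ∉ (q - x) ∪ ⁅ y ⁆
    z∉ z∈′ with x∈p∪q⁻ (q - x) ⁅ y ⁆ z∈′
    ... | inj₁ z∈q-x = x∈p─q⇒x∉q p q z∈p─q (p─q⊆p q _ z∈q-x)
    ... | inj₂ z∈⁅y⁆ = x∈p─q⇒x∉q _ ⁅ y ⁆ z∈p─q-y z∈⁅y⁆
  ... | inj₂ z∈⁅x⁆ = subst (_∈ _) (sym (x∈⁅y⁆⇒x≡y x z∈⁅x⁆)) (x∈p∧x∉q⇒x∈p─q (q⊆p x∈q) x∉)
    where
    x∉ : x ∉ (q - x) ∪ ⁅ y ⁆
    x∉ x∈′ with x∈p∪q⁻ (q - x) ⁅ y ⁆ x∈′
    ... | inj₁ x∈q-x = x∈p─q⇒x∉q q ⁅ x ⁆ x∈q-x (x∈⁅x⁆ x)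
    ... | inj₂ x∈⁅y⁆ = y∉q (subst (_∈ q) (x∈⁅y⁆⇒x≡y y x∈⁅y⁆) x∈q)

x∈p∧q∩p⊆⁅x⁆⇒p≡⁅x⁆∪[p─q] : x ∈ p → (∀ {z} → z ∈ q → z ∈ p → z ≡ x) → p ≡ ⁅ x ⁆ ∪ (p ─ q)
x∈p∧q∩p⊆⁅x⁆⇒p≡⁅x⁆∪[p─q] {x = x} {p = p} {q = q} x∈p q∩p⊆⁅x⁆ = ⊆-antisym ⊆ʳ ⊆ˡ
  where
  ⊆ʳ : p ⊆ ⁅ x ⁆ ∪ (p ─ q)
  ⊆ʳ {z} z∈p with z ∈? q
  ... | yes z∈q = p⊆p∪q _ (subst (_∈ ⁅ x ⁆) (sym (q∩p⊆⁅x⁆ z∈q z∈p)) (x∈⁅x⁆ x))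
  ... | no  z∉q = q⊆p∪q ⁅ x ⁆ _ (x∈p∧x∉q⇒x∈p─q z∈p z∉q)
  ⊆ˡ : ⁅ x ⁆ ∪ (p ─ q) ⊆ p
  ⊆ˡ z∈ with x∈p∪q⁻ ⁅ x ⁆ (p ─ q) z∈
  ... | inj₁ z∈⁅x⁆ = subst (_∈ p) (sym (x∈⁅y⁆⇒x≡y x z∈⁅x⁆)) x∈p
  ... | inj₂ z∈p─q = p─q⊆p p q z∈p─q

z∈⁅x⁆∪⁅y⁆⇒z≡x⊎z≡y : z ∈ ⁅ x ⁆ ∪ ⁅ y ⁆ → z ≡ x ⊎ z ≡ y
z∈⁅x⁆∪⁅y⁆⇒z≡x⊎z≡y {x = x} {y = y} z∈ with x∈p∪q⁻ ⁅ x ⁆ ⁅ y ⁆ z∈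
... | inj₁ z∈⁅x⁆ = inj₁ (x∈⁅y⁆⇒x≡y x z∈⁅x⁆)
... | inj₂ z∈⁅y⁆ = inj₂ (x∈⁅y⁆⇒x≡y y z∈⁅y⁆)

pair-covered : w ∈ ⁅ x ⁆ ∪ ⁅ y ⁆ → w′ ∈ ⁅ x ⁆ ∪ ⁅ y ⁆ → w ≢ w′ →
               z ∈ ⁅ x ⁆ ∪ ⁅ y ⁆ → z ≡ w ⊎ z ≡ w′
pair-covered w∈ w′∈ w≢w′ z∈
  with z∈⁅x⁆∪⁅y⁆⇒z≡x⊎z≡y w∈ | z∈⁅x⁆∪⁅y⁆⇒z≡x⊎z≡y w′∈ | z∈⁅x⁆∪⁅y⁆⇒z≡x⊎z≡y z∈
... | inj₁ refl | _         | inj₁ refl = inj₁ refl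
... | inj₂ refl | _         | inj₂ refl = inj₁ refl
... | _         | inj₁ refl | inj₁ refl = inj₂ refl
... | _         | inj₂ refl | inj₂ refl = inj₂ refl
... | inj₁ refl | inj₁ refl | _         = contradiction refl w≢w′
... | inj₂ refl | inj₂ refl | _         = contradiction refl w≢w′

x≢y⇒⁅z⁆⊂⁅x⁆∪⁅y⁆ : x ≢ y → z ∈ ⁅ x ⁆ ∪ ⁅ y ⁆ → ⁅ z ⁆ ⊂ ⁅ x ⁆ ∪ ⁅ y ⁆
x≢y⇒⁅z⁆⊂⁅x⁆∪⁅y⁆ {x = x} {y = y} {z = z} x≢y z∈ = ⁅z⁆⊆ , other
  where
  ⁅z⁆⊆ : ⁅ z ⁆ ⊆ ⁅ x ⁆ ∪ ⁅ y ⁆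
  ⁅z⁆⊆ u∈ = subst (_∈ _) (sym (x∈⁅y⁆⇒x≡y z u∈)) z∈
  other : ∃[ u ] (u ∈ ⁅ x ⁆ ∪ ⁅ y ⁆ × u ∉ ⁅ z ⁆)
  other with z∈⁅x⁆∪⁅y⁆⇒z≡x⊎z≡y z∈
  ... | inj₁ refl = y , q⊆p∪q ⁅ x ⁆ ⁅ y ⁆ (x∈⁅x⁆ y) , x≢y ∘ sym ∘ x∈⁅y⁆⇒x≡y z
  ... | inj₂ refl = x , p⊆p∪q ⁅ y ⁆ (x∈⁅x⁆ x) , x≢y ∘ x∈⁅y⁆⇒x≡y z

p─r─[q─r]≡p─q─r : ∀ (p q r : Subset n) → (p ─ r) ─ (q ─ r) ≡ (p ─ q) ─ r
p─r─[q─r]≡p─q─r []      []      []      = refl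
p─r─[q─r]≡p─q─r (_ ∷ p) (_       ∷ q) (inside  ∷ r) = cong (outside ∷_) (p─r─[q─r]≡p─q─r p q r)
p─r─[q─r]≡p─q─r (_ ∷ p) (inside  ∷ q) (outside ∷ r) = cong (outside ∷_) (p─r─[q─r]≡p─q─r p q r)
p─r─[q─r]≡p─q─r (s ∷ p) (outside ∷ q) (outside ∷ r) = cong (s ∷_) (p─r─[q─r]≡p─q─r p q r)

[p∪q]─[p₁∪q₁]≡p₂∪q₂⇒q₂≡q─q₁ : ∀ {p₁ p₂ q₁ q₂ : Subset n} → (∀ {z} → z ∈ p → z ∉ q) →
  p₁ ⊆ p → p₂ ⊆ p → q₁ ⊆ q → q₂ ⊆ q → (p ∪ q) ─ (p₁ ∪ q₁) ≡ p₂ ∪ q₂ → q₂ ≡ q ─ q₁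
[p∪q]─[p₁∪q₁]≡p₂∪q₂⇒q₂≡q─q₁ {p = p} {q = q} {p₁} {p₂} {q₁} {q₂} disjoint p₁⊆p p₂⊆p q₁⊆q q₂⊆q eq =
  ⊆-antisym ⊆ʳ ⊆ˡ
  where
  ⊆ʳ : q₂ ⊆ q ─ q₁
  ⊆ʳ z∈q₂ = x∈p∧x∉q⇒x∈p─q (q₂⊆q z∈q₂) (x∈p─q⇒x∉q _ _ z∈ ∘ q⊆p∪q p₁ q₁)
    where z∈ = subst (_ ∈_) (sym eq) (q⊆p∪q p₂ q₂ z∈q₂)
  ⊆ˡ : q ─ q₁ ⊆ q₂
  ⊆ˡ z∈q─q₁ with x∈p∪q⁻ p₂ q₂ (subst (_ ∈_) eq (x∈p∧x∉q⇒x∈p─q (q⊆p∪q p q z∈q) z∉p₁∪q₁))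
    where
    z∈q = p─q⊆p q q₁ z∈q─q₁
    z∉p₁∪q₁ = [ (λ z∈p₁ → disjoint (p₁⊆p z∈p₁) z∈q) , x∈p─q⇒x∉q q q₁ z∈q─q₁ ] ∘ x∈p∪q⁻ p₁ q₁
  ... | inj₁ z∈p₂ = contradiction (p─q⊆p q q₁ z∈q─q₁) (disjoint (p₂⊆p z∈p₂))
  ... | inj₂ z∈q₂ = z∈q₂

-- Duality

BasesInGround : SetSystem n → Set
BasesInGround T = ∀ B → IsBase T B → B ⊆ ground T

complement-base : B ⊆ ground T → IsBase T B → IsBase (dual T) (ground T ─ B)
complement-base {B = B} {T = T} B⊆E b =
  p─q⊆p (ground T) B , subst (IsBase T) (sym (p⊆q⇒q─[q─p]≡p B (ground T) B⊆E)) b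

complement-of-base : (M : Matroid n) → IsBase (sys M) B → IsBase (dual (sys M)) (ground (sys M) ─ B)
complement-of-base M b = complement-base {T = sys M} (base⊆ground M _ b) b

CommonBase-complement : CommonBase T B → CommonBase T (ground T ─ B)
CommonBase-complement {T = T} (b , B⊆E , b*) = b* , complement-base {T = T} B⊆E b

CommonBase-dual⇔ : CommonBase T B ⇔ CommonBase (dual T) B
CommonBase-dual⇔ {T = T} {B = B} = mk⇔
  (λ (b , b*@(B⊆E , _)) → b* , B⊆E , complement-base {T = T} B⊆E b)
  (λ ((B⊆E , b*) , _ , _ , b) → subst (IsBase T) (p⊆q⇒q─[q─p]≡p B (ground T) B⊆E) b , B⊆E , b*)

IsBlock-dual : IsBlock T → IsBlock (dual T)
IsBlock-dual {T = T} = map₂ (Equivalence.to (CommonBase-dual⇔ {T = T}))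

HasRank-dual : ∣ ground T ∣ ≡ s + r → HasRank T r → HasRank (dual T) s
HasRank-dual {T = T} {s = s} {r = r} ∣E∣≡s+r rk B (B⊆E , b) = +-cancelʳ-≡ r ∣ B ∣ s (begin
  ∣ B ∣ + r                 ≡⟨ cong (∣ B ∣ +_) (rk _ b) ⟨
  ∣ B ∣ + ∣ ground T ─ B ∣  ≡⟨ p⊆q⇒∣p∣+∣q─p∣≡∣q∣ B (ground T) B⊆E ⟩
  ∣ ground T ∣              ≡⟨ ∣E∣≡s+r ⟩
  s + r                     ∎)
  where open ≡-Reasoning

IsBlock⇒HasRank-dual : HasRank T r → IsBlock T → HasRank (dual T) r
IsBlock⇒HasRank-dual {T = T} {r = r} rk (B , b , B⊆E , b*) = HasRank-dual ∣E∣≡r+r rk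
  where
  ∣E∣≡r+r : ∣ ground T ∣ ≡ r + r
  ∣E∣≡r+r = trans (sym (p⊆q⇒∣p∣+∣q─p∣≡∣q∣ B (ground T) B⊆E)) (cong₂ _+_ (rk B b) (rk _ b*))

CommonBase-⊕-dual⇔ : BasesInGround R → BasesInGround T → (∀ {z} → z ∈ ground R → z ∉ ground T) →
                     CommonBase (R ⊕ T) B ⇔ CommonBase (R ⊕ dual T) B
CommonBase-⊕-dual⇔ {R = R} {T = T} R-in-ground T-in-ground disjoint = mk⇔ to from
  where
  G = ground T
  complement-part : ∀ {B₁ B₂ B₁′ B₂′} → IsBase R B₁ → IsBase R B₁′ → B₂ ⊆ G → B₂′ ⊆ G →
                    (ground R ∪ G) ─ (B₁ ∪ B₂) ≡ B₁′ ∪ B₂′ → B₂′ ≡ G ─ B₂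
  complement-part b₁ b₁′ B₂⊆G B₂′⊆G =
    [p∪q]─[p₁∪q₁]≡p₂∪q₂⇒q₂≡q─q₁ disjoint (R-in-ground _ b₁) (R-in-ground _ b₁′) B₂⊆G B₂′⊆G
  to : CommonBase (R ⊕ T) B → CommonBase (R ⊕ dual T) B
  to ((B₁ , B₂ , b₁ , b₂ , B≡) , B⊆ , B₁′ , B₂′ , b₁′ , b₂′ , B*≡) =
    (B₁ , B₂ , b₁ , (B₂⊆G , subst (IsBase T) B₂′≡G─B₂ b₂′) , B≡) ,
    B⊆ , B₁′ , G ─ B₂ , b₁′ , complement-base {T = T} B₂⊆G b₂ , trans B*≡ (cong (B₁′ ∪_) B₂′≡G─B₂)
    where
    B₂⊆G = T-in-ground _ b₂
    B₂′≡G─B₂ = complement-part b₁ b₁′ B₂⊆G (T-in-ground _ b₂′) (subst (λ A → _ ─ A ≡ _) B≡ B*≡)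
  from : CommonBase (R ⊕ dual T) B → CommonBase (R ⊕ T) B
  from ((B₁ , D₂ , b₁ , (D₂⊆G , d₂) , B≡) , B⊆ , B₁′ , D₂′ , b₁′ , (D₂′⊆G , d₂′) , B*≡) =
    (B₁ , G ─ D₂′ , b₁ , d₂′ , trans B≡ (cong (B₁ ∪_) (sym G─D₂′≡D₂))) ,
    B⊆ , B₁′ , G ─ D₂ , b₁′ , d₂ , trans B*≡ (cong (B₁′ ∪_) D₂′≡G─D₂)
    where
    D₂′≡G─D₂ = complement-part b₁ b₁′ D₂⊆G D₂′⊆G (subst (λ A → _ ─ A ≡ _) B≡ B*≡)
    G─D₂′≡D₂ = trans (cong (G ─_) D₂′≡G─D₂) (p⊆q⇒q─[q─p]≡p D₂ G D₂⊆G)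

uniform-1-base : ∀ {C : Subset n} → w ∈ C → IsBase (uniform 1 C) ⁅ w ⁆
uniform-1-base {w = w} w∈C = (λ z∈⁅w⁆ → subst (_∈ _) (sym (x∈⁅y⁆⇒x≡y w z∈⁅w⁆)) w∈C) , ∣⁅x⁆∣≡1 w

uniform-1-base⁻ : ∀ {C : Subset n} → IsBase (uniform 1 C) B → ∃[ w ] (w ∈ C × B ≡ ⁅ w ⁆)
uniform-1-base⁻ {B = B} (B⊆C , ∣B∣≡1) with ∣p∣≡1⇒p≡⁅x⁆ B ∣B∣≡1
... | w , refl = w , B⊆C (x∈⁅x⁆ w) , refl

module DualMatroid (M : Matroid n) (rk : HasRank (sys M) r) where

  private
    S = sys M
    E = ground S

  exchange-toward : ∀ {B₁ B₂} → IsBase S B₁ → IsBase S B₂ → w ∈ B₂ → w ∉ B₁ →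
                    ∃[ v ] (v ∈ B₁ × IsBase S ((B₂ - w) ∪ ⁅ v ⁆) × ∣ ((B₂ - w) ∪ ⁅ v ⁆) ─ B₁ ∣ < ∣ B₂ ─ B₁ ∣)
  exchange-toward b₁ b₂ w∈B₂ w∉B₁ with exchange M _ _ b₂ b₁ _ w∈B₂ w∉B₁
  ... | v , v∈B₁ , _ , b = v , v∈B₁ , b , ∣[p-x]∪⁅y⁆─q∣<∣p─q∣ w∈B₂ w∉B₁ v∈B₁

  -- k bounds ∣ B₂ ─ B₁ ∣. Exchanging an element of B₂ ─ B₁ other than x towards B₁ shrinks
  -- it; once x is all that is left, any exchange out of B₁ towards B₂ must bring in x.
  co-exchange-within : ∀ {B₁ B₂} k → ∣ B₂ ─ B₁ ∣ < k → IsBase S B₁ → IsBase S B₂ → x ∈ B₂ → x ∉ B₁ →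
                       ∃[ y ] (y ∈ B₁ × y ∉ B₂ × IsBase S ((B₁ - y) ∪ ⁅ x ⁆))
  co-exchange-within {x = x} {B₁} {B₂} (suc k) <k b₁ b₂ x∈B₂ x∉B₁ with nonempty? ((B₂ ─ B₁) - x)
  ... | yes (w , w∈B₂─B₁-x) = via-closer-base
    where
    w∈B₂─B₁ = p─q⊆p _ ⁅ x ⁆ w∈B₂─B₁-x
    w∈B₂ = p─q⊆p B₂ B₁ w∈B₂─B₁
    w∉B₁ = x∈p─q⇒x∉q B₂ B₁ w∈B₂─B₁
    w≢x = x∉⁅y⁆⇒x≢y (x∈p─q⇒x∉q _ ⁅ x ⁆ w∈B₂─B₁-x)
    via-closer-base : ∃[ y ] (y ∈ B₁ × y ∉ B₂ × IsBase S ((B₁ - y) ∪ ⁅ x ⁆))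
    via-closer-base with exchange-toward b₁ b₂ w∈B₂ w∉B₁
    ... | v , _ , b₂′ , closer
      with co-exchange-within k (<-≤-trans closer (s≤s⁻¹ <k)) b₁ b₂′
             (p⊆p∪q ⁅ v ⁆ (x∈p∧x≢y⇒x∈p-y x∈B₂ (w≢x ∘ sym))) x∉B₁
    ... | y , y∈B₁ , y∉B₂′ , b = y , y∈B₁ , y∉B₂ , b
      where
      y∉B₂ : y ∉ B₂
      y∉B₂ y∈B₂ = y∉B₂′ (p⊆p∪q _ (x∈p∧x≢y⇒x∈p-y y∈B₂ λ { refl → w∉B₁ y∈B₁ }))
  ... | no B₂─B₁⊆⁅x⁆ with nonempty? (B₁ ─ B₂)
  ...   | yes (y , y∈B₁─B₂) with exchange M B₁ B₂ b₁ b₂ y (p─q⊆p B₁ B₂ y∈B₁─B₂) (x∈p─q⇒x∉q B₁ B₂ y∈B₁─B₂)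
  ...     | z , z∈B₂ , z∉B₁ , b with z ≟ᶠ x
  ...       | yes refl = y , p─q⊆p B₁ B₂ y∈B₁─B₂ , x∈p─q⇒x∉q B₁ B₂ y∈B₁─B₂ , b
  ...       | no  z≢x  = contradiction (z , x∈p∧x≢y⇒x∈p-y (x∈p∧x∉q⇒x∈p─q z∈B₂ z∉B₁) z≢x) B₂─B₁⊆⁅x⁆
  co-exchange-within {x = x} {B₁} {B₂} (suc k) _ b₁ b₂ x∈B₂ x∉B₁ | no _ | no B₁─B₂-empty =
    contradiction (trans (rk B₁ b₁) (sym (rk B₂ b₂))) (<⇒≢ (p⊂q⇒∣p∣<∣q∣ (B₁⊆B₂ , x , x∈B₂ , x∉B₁)))
    where
    B₁⊆B₂ : B₁ ⊆ B₂
    B₁⊆B₂ z∈B₁ = x∈p∧x∉p─q⇒x∈q z∈B₁ (B₁─B₂-empty ∘ (_ ,_))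

  co-exchange : ∀ {B₁ B₂} → IsBase S B₁ → IsBase S B₂ → x ∈ B₂ → x ∉ B₁ →
                ∃[ y ] (y ∈ B₁ × y ∉ B₂ × IsBase S ((B₁ - y) ∪ ⁅ x ⁆))
  co-exchange = co-exchange-within _ ≤-refl

  dual-exchange : ∀ {D₁ D₂} → IsBase (dual S) D₁ → IsBase (dual S) D₂ → x ∈ D₁ → x ∉ D₂ →
                  ∃[ y ] (y ∈ D₂ × y ∉ D₁ × IsBase (dual S) ((D₁ - x) ∪ ⁅ y ⁆))
  dual-exchange {x = x} {D₁} {D₂} (D₁⊆E , b₁) (D₂⊆E , b₂) x∈D₁ x∉D₂
    with co-exchange b₁ b₂ (x∈p∧x∉q⇒x∈p─q (D₁⊆E x∈D₁) x∉D₂) (λ x∈E─D₁ → x∈p─q⇒x∉q E D₁ x∈E─D₁ x∈D₁)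
  ... | y , y∈E─D₁ , y∉E─D₂ , b = y , y∈D₂ , y∉D₁ , D⊆E , subst (IsBase S) (sym E─D≡) b
    where
    y∈E = p─q⊆p E D₁ y∈E─D₁
    y∉D₁ = x∈p─q⇒x∉q E D₁ y∈E─D₁
    y∈D₂ = x∈p∧x∉p─q⇒x∈q y∈E y∉E─D₂
    D⊆E : (D₁ - x) ∪ ⁅ y ⁆ ⊆ E
    D⊆E z∈ = [ D₁⊆E ∘ p─q⊆p D₁ ⁅ x ⁆ , (λ z∈⁅y⁆ → subst (_∈ E) (sym (x∈⁅y⁆⇒x≡y y z∈⁅y⁆)) y∈E) ]
               (x∈p∪q⁻ (D₁ - x) ⁅ y ⁆ z∈)
    E─D≡ = p─[q-x∪⁅y⁆]≡[p─q]-y∪⁅x⁆ D₁⊆E x∈D₁ y∉D₁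

  dualMatroid : Matroid n
  dualMatroid = record
    { sys         = dual S
    ; base⊆ground = λ _ → proj₁
    ; base-exists = let (B , b) = base-exists M in E ─ B , complement-of-base M b
    ; exchange    = λ _ _ d₁ d₂ _ → dual-exchange d₁ d₂
    }

-- Deleting a two-element cocircuit

deletion-base-restricts : BasesInGround T → IsBase (delete T X) B′ → IsBase T B → B′ ⊆ B → B ─ X ≡ B′
deletion-base-restricts {T = T} {X = X} {B′ = B′} {B = B} in-ground (_ , B′⊆E─X , maximal) b B′⊆B =
  ⊆-antisym (maximal (B ─ X) (B , b , p─q⊆p B X) B─X⊆E─X B′⊆B─X) B′⊆B─X
  where
  B─X⊆E─X : B ─ X ⊆ ground T ─ X
  B─X⊆E─X z∈ = x∈p∧x∉q⇒x∈p─q (in-ground B b (p─q⊆p B X z∈)) (x∈p─q⇒x∉q B X z∈)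
  B′⊆B─X : B′ ⊆ B ─ X
  B′⊆B─X z∈ = x∈p∧x∉q⇒x∈p─q (B′⊆B z∈) (x∈p─q⇒x∉q (ground T) X (B′⊆E─X z∈))

circuit-meets-cobases : ∀ {C : Subset n} → IsCircuit T C → (∀ {B} → IsBase T′ B → IsBase T (ground T ─ B)) →
                        IsBase T′ B → ∃[ w ] (w ∈ C × w ∈ B)
circuit-meets-cobases {T = T} {B = B} {C = C} ((C⊆E , C-dependent) , _) complement b with nonempty? (C ∩ B)
... | yes (w , w∈C∩B) = w , x∈p∩q⁻ C B w∈C∩B
... | no  C∩B-empty   = ⊥-elim (C-dependent (ground T ─ B , complement b , C⊆E─B))
  where
  C⊆E─B : C ⊆ ground T ─ B
  C⊆E─B z∈C = x∈p∧x∉q⇒x∈p─q (C⊆E z∈C) (λ z∈B → C∩B-empty (_ , x∈p∩q⁺ (z∈C , z∈B)))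

pair-circuit-avoided-by-cobase : IsCircuit T (⁅ x ⁆ ∪ ⁅ y ⁆) → x ≢ y →
                                 (∀ {B} → IsBase T B → IsBase T′ (ground T ─ B)) →
                                 w ∈ ⁅ x ⁆ ∪ ⁅ y ⁆ → ∃[ B ] (IsBase T′ B × w ∉ B)
pair-circuit-avoided-by-cobase {T = T} {w = w} (_ , minimal) x≢y complement w∈C
  with minimal ⁅ w ⁆ (x≢y⇒⁅z⁆⊂⁅x⁆∪⁅y⁆ x≢y w∈C)
... | B , b , ⁅w⁆⊆B = ground T ─ B , complement b , λ w∈E─B → x∈p─q⇒x∉q (ground T) B w∈E─B (⁅w⁆⊆B (x∈⁅x⁆ w))

-- The cocircuit hypothesis enters only through meets and avoided; stated this way the
-- module also applies to M* in the circuit case, where dual (dual (sys M)) is not sys M.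
module PairCocircuitDeletion (M : Matroid n) (rk : HasRank (sys M) r) {x y : Fin n}
  (C⊆E : ⁅ x ⁆ ∪ ⁅ y ⁆ ⊆ ground (sys M))
  (meets : ∀ {B} → IsBase (sys M) B → ∃[ w ] (w ∈ ⁅ x ⁆ ∪ ⁅ y ⁆ × w ∈ B))
  (avoided : ∀ {w} → w ∈ ⁅ x ⁆ ∪ ⁅ y ⁆ → ∃[ B ] (IsBase (sys M) B × w ∉ B)) where

  private
    S = sys M
    E = ground S
    C = ⁅ x ⁆ ∪ ⁅ y ⁆
    N = delete S C

  deletion-base-avoids-C : IsBase N B′ → z ∈ B′ → z ∉ C
  deletion-base-avoids-C (_ , B′⊆E─C , _) z∈B′ = x∈p─q⇒x∉q E C (B′⊆E─C z∈B′)

  -- The element brought in lies in C, for otherwise it would enlarge B′ within E ─ C.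
  exchange-in-C : IsBase N B′ → IsBase S B → B′ ⊆ B → w ∈ C → w ∈ B →
                  ∃[ z ] (z ∈ C × z ∉ B × IsBase S ((B - w) ∪ ⁅ z ⁆) × B′ ⊆ (B - w) ∪ ⁅ z ⁆)
  exchange-in-C {B′ = B′} {B = B} {w = w} bN b B′⊆B w∈C w∈B with avoided w∈C
  ... | Bw , bw , w∉Bw with exchange M B Bw b bw w w∈B w∉Bw
  ... | z , _ , z∉B , b′ = z , z∈C , z∉B , b′ , B′⊆B′′
    where
    B′⊆B′′ : B′ ⊆ (B - w) ∪ ⁅ z ⁆
    B′⊆B′′ u∈B′ = p⊆p∪q _ (x∈p∧x≢y⇒x∈p-y (B′⊆B u∈B′) λ { refl → deletion-base-avoids-C bN u∈B′ w∈C })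
    z∈C : z ∈ C
    z∈C with z ∈? C
    ... | yes z∈C = z∈C
    ... | no  z∉C = contradiction (B′⊆B (subst (z ∈_) B′′─C≡B′ (x∈p∧x∉q⇒x∈p─q (q⊆p∪q _ ⁅ z ⁆ (x∈⁅x⁆ z)) z∉C))) z∉B
      where B′′─C≡B′ = deletion-base-restricts (base⊆ground M) bN b′ B′⊆B′′

  meets-C-once : IsBase N B′ → IsBase S B → B′ ⊆ B → z ∈ C → z ∈ B → w ∈ C → w ∈ B → z ≡ w
  meets-C-once {z = z} {w = w} bN b B′⊆B z∈C z∈B w∈C w∈B with z ≟ᶠ w
  ... | yes z≡w = z≡w
  ... | no  z≢w with exchange-in-C bN b B′⊆B z∈C z∈B
  ...   | v , v∈C , v∉B , _ with pair-covered z∈C w∈C z≢w v∈C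
  ...     | inj₁ refl = contradiction z∈B v∉B
  ...     | inj₂ refl = contradiction w∈B v∉B

  base-above-containing : IsBase N B′ → w ∈ C → ∃[ B ] (IsBase S B × B′ ⊆ B × w ∈ B)
  base-above-containing {w = w} bN@((B , b , B′⊆B) , _) w∈C with meets b
  ... | u , u∈C , u∈B with u ≟ᶠ w
  ...   | yes refl = B , b , B′⊆B , u∈B
  ...   | no  u≢w with exchange-in-C bN b B′⊆B u∈C u∈B
  ...     | v , v∈C , v∉B , b′ , B′⊆B′′ with pair-covered u∈C w∈C u≢w v∈C
  ...       | inj₁ refl = contradiction u∈B v∉B
  ...       | inj₂ refl = _ , b′ , B′⊆B′′ , q⊆p∪q _ ⁅ v ⁆ (x∈⁅x⁆ v)

  deletion-base⇒base : IsBase N B′ → w ∈ C → IsBase S (⁅ w ⁆ ∪ B′)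
  deletion-base⇒base {B′ = B′} {w = w} bN w∈C with base-above-containing bN w∈C
  ... | B , b , B′⊆B , w∈B = subst (IsBase S) B≡⁅w⁆∪B′ b
    where
    open ≡-Reasoning
    B≡⁅w⁆∪B′ : B ≡ ⁅ w ⁆ ∪ B′
    B≡⁅w⁆∪B′ = begin
      B                ≡⟨ x∈p∧q∩p⊆⁅x⁆⇒p≡⁅x⁆∪[p─q] w∈B (λ z∈C z∈B → meets-C-once bN b B′⊆B z∈C z∈B w∈C w∈B) ⟩
      ⁅ w ⁆ ∪ (B ─ C)  ≡⟨ cong (⁅ w ⁆ ∪_) (deletion-base-restricts (base⊆ground M) bN b B′⊆B) ⟩
      ⁅ w ⁆ ∪ B′       ∎

  base⇒deletion-base : B′ ⊆ E ─ C → w ∈ C → IsBase S (⁅ w ⁆ ∪ B′) → IsBase N B′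
  base⇒deletion-base {B′ = B′} {w = w} B′⊆E─C w∈C b = (_ , b , q⊆p∪q ⁅ w ⁆ B′) , B′⊆E─C , maximal
    where
    ∉C : ∀ {z} → z ∈ B′ → z ∉ C
    ∉C z∈B′ = x∈p─q⇒x∉q E C (B′⊆E─C z∈B′)
    -- A base B ⊇ ⁅ z ⁆ ∪ B′ with z ∉ B′ equals ⁅ z ⁆ ∪ B′ by size, so it misses C.
    maximal : ∀ J → Independent S J → J ⊆ E ─ C → B′ ⊆ J → J ⊆ B′
    maximal J (B , b′ , J⊆B) J⊆E─C B′⊆J {z} z∈J with z ∈? B′
    ... | yes z∈B′ = z∈B′
    ... | no  z∉B′ with meets b′
    ...   | u , u∈C , u∈B with x∈p∪q⁻ ⁅ z ⁆ B′ (B⊆⁅z⁆∪B′ u∈B)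
      where
      open ≡-Reasoning
      ⁅z⁆∪B′⊆B : ⁅ z ⁆ ∪ B′ ⊆ B
      ⁅z⁆∪B′⊆B v∈ = [ (λ v∈⁅z⁆ → J⊆B (subst (_∈ J) (sym (x∈⁅y⁆⇒x≡y z v∈⁅z⁆)) z∈J)) , J⊆B ∘ B′⊆J ]
                      (x∈p∪q⁻ ⁅ z ⁆ B′ v∈)
      ∣B∣≡∣⁅z⁆∪B′∣ : ∣ B ∣ ≡ ∣ ⁅ z ⁆ ∪ B′ ∣
      ∣B∣≡∣⁅z⁆∪B′∣ = begin
        ∣ B ∣            ≡⟨ rk B b′ ⟩
        r                ≡⟨ rk _ b ⟨
        ∣ ⁅ w ⁆ ∪ B′ ∣   ≡⟨ x∉p⇒∣⁅x⁆∪p∣≡1+∣p∣ B′ (λ w∈B′ → ∉C w∈B′ w∈C) ⟩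
        suc ∣ B′ ∣       ≡⟨ x∉p⇒∣⁅x⁆∪p∣≡1+∣p∣ B′ z∉B′ ⟨
        ∣ ⁅ z ⁆ ∪ B′ ∣   ∎
      B⊆⁅z⁆∪B′ = p⊆q∧∣q∣≤∣p∣⇒q⊆p ⁅z⁆∪B′⊆B (≤-reflexive ∣B∣≡∣⁅z⁆∪B′∣)
    ...     | inj₁ u∈⁅z⁆ = contradiction (subst (_∈ C) (x∈⁅y⁆⇒x≡y z u∈⁅z⁆) u∈C) (x∈p─q⇒x∉q E C (J⊆E─C z∈J))
    ...     | inj₂ u∈B′ = contradiction u∈C (∉C u∈B′)

  deletion-rank : HasRank N (r ∸ 1)
  deletion-rank B′ bN = cong (_∸ 1) (begin
    suc ∣ B′ ∣      ≡⟨ x∉p⇒∣⁅x⁆∪p∣≡1+∣p∣ B′ (λ x∈B′ → deletion-base-avoids-C bN x∈B′ x∈C) ⟨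
    ∣ ⁅ x ⁆ ∪ B′ ∣  ≡⟨ rk _ (deletion-base⇒base bN x∈C) ⟩
    r               ∎)
    where
    open ≡-Reasoning
    x∈C = p⊆p∪q ⁅ y ⁆ (x∈⁅x⁆ x)

  common-base-splits : CommonBase S B → ∃[ w ] (w ∈ C × IsBase N (B ─ C) × B ≡ ⁅ w ⁆ ∪ (B ─ C))
  common-base-splits {B = B} (b , _ , b*) with meets b | meets b*
  ... | w , w∈C , w∈B | w′ , w′∈C , w′∈E─B =
    w , w∈C , base⇒deletion-base B─C⊆E─C w∈C (subst (IsBase S) B≡ b) , B≡
    where
    w′∉B = x∈p─q⇒x∉q E B w′∈E─B
    B≡ : B ≡ ⁅ w ⁆ ∪ (B ─ C)
    B≡ = x∈p∧q∩p⊆⁅x⁆⇒p≡⁅x⁆∪[p─q] w∈B λ z∈C z∈B →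
           [ id , (λ { refl → contradiction z∈B w′∉B }) ] (pair-covered w∈C w′∈C (λ { refl → w′∉B w∈B }) z∈C)
    B─C⊆E─C : B ─ C ⊆ E ─ C
    B─C⊆E─C z∈ = x∈p∧x∉q⇒x∈p─q (base⊆ground M B b (p─q⊆p B C z∈)) (x∈p─q⇒x∉q B C z∈)

  deletion-block : IsBlock S → IsBlock N
  deletion-block (B , cb@(_ , B⊆E , _)) with common-base-splits cb | common-base-splits (CommonBase-complement {T = S} cb)
  ... | _ , _ , bN , _ | _ , _ , bN* , _ =
    B ─ C , bN , B─C⊆E─C , subst (IsBase N) (sym (p─r─[q─r]≡p─q─r E B C)) bN*
    where
    B─C⊆E─C : B ─ C ⊆ E ─ C
    B─C⊆E─C z∈ = x∈p∧x∉q⇒x∈p─q (B⊆E (p─q⊆p B C z∈)) (x∈p─q⇒x∉q B C z∈)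

  private
    C∪[E─C]≡E : C ∪ (E ─ C) ≡ E
    C∪[E─C]≡E = p⊆q⇒p∪[q─p]≡q C E C⊆E

  common-base⇒sum-common-base : CommonBase S B → CommonBase (uniform 1 C ⊕ N) B
  common-base⇒sum-common-base {B = B} cb@(_ , B⊆E , _)
    with common-base-splits cb | common-base-splits (CommonBase-complement {T = S} cb)
  ... | w , w∈C , bN , B≡ | w′ , w′∈C , bN* , E─B≡ =
    (⁅ w ⁆ , B ─ C , uniform-1-base w∈C , bN , B≡) ,
    subst (B ⊆_) (sym C∪[E─C]≡E) B⊆E ,
    ⁅ w′ ⁆ , (E ─ B) ─ C , uniform-1-base w′∈C , bN* , trans (cong (_─ B) C∪[E─C]≡E) E─B≡

  sum-base⇒base : IsBase (uniform 1 C ⊕ N) A → IsBase S A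
  sum-base⇒base (B₁ , B₂ , u , bN , A≡) with uniform-1-base⁻ u
  ... | w , w∈C , refl = subst (IsBase S) (sym A≡) (deletion-base⇒base bN w∈C)

  sum-common-base⇒common-base : CommonBase (uniform 1 C ⊕ N) B → CommonBase S B
  sum-common-base⇒common-base {B = B} (b , B⊆ , b*) =
    sum-base⇒base b , subst (B ⊆_) C∪[E─C]≡E B⊆ , subst (λ G → IsBase S (G ─ B)) C∪[E─C]≡E (sum-base⇒base b*)

  CommonBase-sum⇔ : CommonBase S B ⇔ CommonBase (uniform 1 C ⊕ N) B
  CommonBase-sum⇔ = mk⇔ common-base⇒sum-common-base sum-common-base⇒common-base

two-element-cocircuit-deletion :
  (M : Matroid n) → HasRank (sys M) r → IsBlock (sys M) → x ≢ y → IsCocircuit (sys M) (⁅ x ⁆ ∪ ⁅ y ⁆) →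
  IsBlock (delete (sys M) (⁅ x ⁆ ∪ ⁅ y ⁆)) × HasRank (delete (sys M) (⁅ x ⁆ ∪ ⁅ y ⁆)) (r ∸ 1) ×
  (∀ B → CommonBase (sys M) B ⇔ CommonBase (uniform 1 (⁅ x ⁆ ∪ ⁅ y ⁆) ⊕ delete (sys M) (⁅ x ⁆ ∪ ⁅ y ⁆)) B)
two-element-cocircuit-deletion M rk blk x≢y cocircuit =
  deletion-block blk , deletion-rank , λ _ → CommonBase-sum⇔
  where
  open PairCocircuitDeletion M rk (proj₁ (proj₁ cocircuit))
    (circuit-meets-cobases {T = dual (sys M)} {T′ = sys M} cocircuit (complement-of-base M))
    (pair-circuit-avoided-by-cobase {T = dual (sys M)} {T′ = sys M} cocircuit x≢y proj₂)

two-element-circuit-contraction :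
  (M : Matroid n) → HasRank (sys M) r → IsBlock (sys M) → x ≢ y → IsCircuit (sys M) (⁅ x ⁆ ∪ ⁅ y ⁆) →
  IsBlock (contract (sys M) (⁅ x ⁆ ∪ ⁅ y ⁆)) × HasRank (contract (sys M) (⁅ x ⁆ ∪ ⁅ y ⁆)) (r ∸ 1) ×
  (∀ B → CommonBase (sys M) B ⇔ CommonBase (uniform 1 (⁅ x ⁆ ∪ ⁅ y ⁆) ⊕ contract (sys M) (⁅ x ⁆ ∪ ⁅ y ⁆)) B)
two-element-circuit-contraction {x = x} {y = y} M rk blk x≢y circuit =
  IsBlock-dual N-block , IsBlock⇒HasRank-dual deletion-rank N-block , common-bases
  where
  S = sys M
  C = ⁅ x ⁆ ∪ ⁅ y ⁆
  open DualMatroid M rk using (dualMatroid)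
  open PairCocircuitDeletion dualMatroid (IsBlock⇒HasRank-dual rk blk) (proj₁ (proj₁ circuit))
    (circuit-meets-cobases {T = S} {T′ = dual S} circuit proj₂)
    (pair-circuit-avoided-by-cobase {T = S} {T′ = dual S} circuit x≢y (complement-of-base M))
  N = delete (dual S) C
  N-block : IsBlock N
  N-block = deletion-block (IsBlock-dual blk)
  disjoint : ∀ {z} → z ∈ C → z ∉ ground S ─ C
  disjoint z∈C z∈E─C = x∈p─q⇒x∉q (ground S) C z∈E─C z∈C
  common-bases : ∀ B → CommonBase S B ⇔ CommonBase (uniform 1 C ⊕ dual N) B
  common-bases B = begin
    CommonBase S B                       ≈⟨ CommonBase-dual⇔ {T = S} ⟩
    CommonBase (dual S) B                ≈⟨ CommonBase-sum⇔ ⟩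
    CommonBase (uniform 1 C ⊕ N) B       ≈⟨ CommonBase-⊕-dual⇔ (λ _ → proj₁) (λ _ → proj₁ ∘ proj₂) disjoint ⟩
    CommonBase (uniform 1 C ⊕ dual N) B  ∎
    where open SetoidReasoning (⇔-setoid 0ℓ)

lemma3p2 : {n : ℕ} (M : Matroid n) (r : ℕ) → r ≥ 1 →
           HasRank (sys M) r → IsBlock (sys M) →
           (e f : Fin n) → ¬ (e ≡ f) → e ∈ ground (sys M) → f ∈ ground (sys M) →
           (h : IsCocircuit (sys M) (⁅ e ⁆ ∪ ⁅ f ⁆) ⊎ IsCircuit (sys M) (⁅ e ⁆ ∪ ⁅ f ⁆)) →
           IsBlock (minor (sys M) (⁅ e ⁆ ∪ ⁅ f ⁆) h)
           × HasRank (minor (sys M) (⁅ e ⁆ ∪ ⁅ f ⁆) h) (r ∸ 1)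
           × (∀ B → CommonBase (sys M) B
                    ⇔ CommonBase (uniform 1 (⁅ e ⁆ ∪ ⁅ f ⁆) ⊕ minor (sys M) (⁅ e ⁆ ∪ ⁅ f ⁆) h) B)
-- r ≥ 1 and e, f ∈ E are implied: every base meets C, and a (co)circuit lies in E.
lemma3p2 M _ _ rk blk _ _ e≢f _ _ (inj₁ cocircuit) = two-element-cocircuit-deletion M rk blk e≢f cocircuit
lemma3p2 M _ _ rk blk _ _ e≢f _ _ (inj₂ circuit)   = two-element-circuit-contraction M rk blk e≢f circuit
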